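{- Let $H$ be a linear hypergraph and $\mathscr{N}$ a forest of copies in $H$. Then every copy in $\mathscr{N}$ is initial, i.e., for every $F\in\mathscr{N}$ there is an admissible enumeration of $\mathscr{N}$ whose first member is $F$.
   Context: Hypergraphs are pairs $(V,E)$ with $E$ a set of $k$-subsets of a finite set $V$; linear means two distinct edges share at most one vertex. For a finite set $\mathscr{N}$ of subhypergraphs of $H$, an enumeration $(F_1,\dots,F_{|\mathscr{N}|})$ of $\mathscr{N}$ is admissible if for every $j\in[2,|\mathscr{N}|]$ the set $z_j=V(F_j)\cap\bigcup_{i<j}V(F_i)$ either is an edge in $E(F_j)\cap\bigcup_{i<j}E(F_i)$ or has at most one element; $\mathscr{N}$ is a forest of copies if it has an admissible enumeration. -}

module Defs where

open import Data.Nat using (ℕ; _≤_)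
open import Data.Fin using (Fin; toℕ; _<?_)
open import Data.Fin.Subset using (Subset; _∈_; _⊆_; _∩_; _∪_; ⋃; ∣_∣)
open import Data.Fin.Permutation using (Permutation′; _⟨$⟩ʳ_; _⟨$⟩ˡ_)
open import Data.List using (List; map; filter; allFin)
open import Data.Product using (Σ; _×_; ∃)
open import Data.Sum using (_⊎_)
open import Relation.Nullary using (¬_)
open import Relation.Binary.PropositionalEquality using (_≡_; _≢_)

-- Edges are given by an injective labelling  edge : Fin m → Subset n,
-- so E(H) = { edge e | e : Fin m } is a set of k-subsets of Fin n.
record Hypergraph : Set where
  field
    n k m    : ℕ
    edge     : Fin m → Subset n
    edgeSize : ∀ e → ∣ edge e ∣ ≡ k
    edgeInj  : ∀ e e′ → edge e ≡ edge e′ → e ≡ e′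

open Hypergraph public

Linear : Hypergraph → Set
Linear H = ∀ e e′ → e ≢ e′ → ∣ edge H e ∩ edge H e′ ∣ ≤ 1

record SubHyp (H : Hypergraph) : Set where
  field
    VF     : Subset (n H)
    EF     : Subset (m H)
    closed : ∀ e → e ∈ EF → edge H e ⊆ VF

open SubHyp public

SameSubHyp : {H : Hypergraph} → SubHyp H → SubHyp H → Set
SameSubHyp F G = (VF F ≡ VF G) × (EF F ≡ EF G)

-- A finite set 𝒩 of subhypergraphs of H: an injective family  Fin r → SubHyp H.
Distinct : {H : Hypergraph} {r : ℕ} → (Fin r → SubHyp H) → Set
Distinct {r = r} 𝒩 = ∀ (a b : Fin r) → SameSubHyp (𝒩 a) (𝒩 b) → a ≡ b

below : {r : ℕ} → Fin r → List (Fin r)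
below {r} j = filter (λ i → i <? j) (allFin r)

-- An enumeration of 𝒩 is a permutation π : position ↦ member; F_j = 𝒩 (π j).
Admissible : {H : Hypergraph} {r : ℕ} → (Fin r → SubHyp H) → Permutation′ r → Set
Admissible {H} 𝒩 π = ∀ j →
  let Fj   = 𝒩 (π ⟨$⟩ʳ j)
      prev = map (λ i → 𝒩 (π ⟨$⟩ʳ i)) (below j)
      z    = VF Fj ∩ ⋃ (map VF prev)
      Ep   = EF Fj ∩ ⋃ (map EF prev)
  in (∃ λ e → (e ∈ Ep) × (edge H e ≡ z)) ⊎ (∣ z ∣ ≤ 1)

ForestOfCopies : {H : Hypergraph} {r : ℕ} → (Fin r → SubHyp H) → Set
ForestOfCopies {r = r} 𝒩 = ∃ λ (π : Permutation′ r) → Admissible 𝒩 π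

Initial : {H : Hypergraph} {r : ℕ} → (Fin r → SubHyp H) → Fin r → Set
Initial {r = r} 𝒩 a = ∃ λ (π : Permutation′ r) → Admissible 𝒩 π × (toℕ (π ⟨$⟩ˡ a) ≡ 0)

{-# OPTIONS --safe #-}
module Submission where

-- To bring
-- F_p with p < s to the front, reorder F₁, …, F_{s-1} by induction and keep F_s
-- last: the condition at F_s only depends on the set of earlier members.  To
-- bring F_s itself to the front, observe that its shared vertex set z_s lies in a
-- single earlier member F_{j₀} (z_s is an edge of some earlier member, or has at
-- most one vertex).  Reorder F₁, …, F_{s-1} with F_{j₀} first and prepend F_s:
-- then F_{j₀} meets F_s exactly in z_s, and every later member meets F_s only
-- inside F_{j₀}, so the conditions of all other members are unchanged.

open import Defs
open import Data.Nat as ℕ using (ℕ; zero; suc; z≤n; s≤s)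
import Data.Nat.Properties as ℕ
open import Data.Fin using (Fin; zero; suc; fromℕ; inject₁; punchIn; toℕ; _<_; _≟_; _<?_)
open import Data.Fin.Properties using (toℕ-fromℕ; toℕ-inject₁; inject₁ℕ<; <-asym; <-irrefl)
open import Data.Fin.Subset using (Subset; _∈_; _⊆_; _∩_; _∪_; ⋃; ∣_∣; ⊥; ⁅_⁆)
open import Data.Fin.Subset.Properties
  using ( ⊆-antisym; ⊥⊆; ∉⊥; ∣⊥∣≡0; p⊆q⇒∣p∣≤∣q∣; ∣p∩q∣≤∣q∣; x∈p∩q⁺; x∈p∩q⁻; x∈p∪q⁺; x∈p∪q⁻
        ; ∪-identityʳ; q⊆p∪q; nonempty?; ∣⁅x⁆∣≡1; x∈⁅y⁆⇒x≡y; x∈p∧x≢y⇒x∈p-y; x∈p⇒∣p-x∣<∣p∣ )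
open import Data.Fin.Permutation
  using (Permutation; Permutation′; _⟨$⟩ʳ_; _⟨$⟩ˡ_; id; insert; insert-punchIn; inverseʳ; inverseˡ; _∘ₚ_)
open import Data.List using (List; []; _∷_; map; allFin)
open import Data.List.Membership.Propositional using () renaming (_∈_ to _∈ₗ_)
open import Data.List.Membership.Propositional.Properties using (∈-map⁺; ∈-map⁻; ∈-filter⁺; ∈-filter⁻; ∈-allFin)
open import Data.List.Relation.Binary.Subset.Propositional using () renaming (_⊆_ to _⊆ₗ_)
import Data.List.Relation.Binary.Subset.Propositional.Properties as ⊆ₗ
open import Data.List.Relation.Unary.Any using (here; there)
open import Data.Vec.Functional as Vector using (Vector; init; last)
open import Data.Product using (∃; _×_; _,_; proj₁; proj₂)
open import Data.Sum using (_⊎_; inj₁; inj₂)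
open import Data.Empty using (⊥-elim)
open import Function using (_∘_)
open import Relation.Nullary using (yes; no; contradiction)
open import Relation.Binary.PropositionalEquality using (_≡_; refl; sym; trans; cong; subst; subst₂; _≗_; module ≡-Reasoning)

data LastView {n : ℕ} : Fin (suc n) → Set where
  last-view    : LastView (fromℕ n)
  inject₁-view : (i : Fin n) → LastView (inject₁ i)

lastView : ∀ {n} (i : Fin (suc n)) → LastView i
lastView {zero}  zero    = last-view
lastView {suc n} zero    = inject₁-view zero
lastView {suc n} (suc i) with lastView i
... | last-view      = last-view
... | inject₁-view j = inject₁-view (suc j)

inject₁<fromℕ : ∀ {n} (i : Fin n) → inject₁ i < fromℕ n
inject₁<fromℕ {n} i = subst (toℕ (inject₁ i) ℕ.<_) (sym (toℕ-fromℕ n)) (inject₁ℕ< i)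

inject₁-mono-< : ∀ {n} {i j : Fin n} → i < j → inject₁ i < inject₁ j
inject₁-mono-< {i = i} {j} = subst₂ ℕ._<_ (sym (toℕ-inject₁ i)) (sym (toℕ-inject₁ j))

inject₁-cancel-< : ∀ {n} {i j : Fin n} → inject₁ i < inject₁ j → i < j
inject₁-cancel-< {i = i} {j} = subst₂ ℕ._<_ (toℕ-inject₁ i) (toℕ-inject₁ j)

<-fromℕ⁻ : ∀ {n} {i : Fin (suc n)} → i < fromℕ n → ∃ λ k → inject₁ k ≡ i
<-fromℕ⁻ {i = i} i<last with lastView i
... | last-view      = contradiction i<last (<-irrefl refl)
... | inject₁-view k = k , refl

<-inject₁⁻ : ∀ {n} {i : Fin (suc n)} {j : Fin n} → i < inject₁ j → ∃ λ k → k < j × inject₁ k ≡ i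
<-inject₁⁻ {i = i} {j} i<j with lastView i
... | last-view      = contradiction i<j (<-asym (inject₁<fromℕ j))
... | inject₁-view k = k , inject₁-cancel-< i<j , refl

punchIn-fromℕ : ∀ {n} (i : Fin n) → punchIn (fromℕ n) i ≡ inject₁ i
punchIn-fromℕ zero    = refl
punchIn-fromℕ (suc i) = cong suc (punchIn-fromℕ i)

insert-lookup : ∀ {m n} i j (π : Permutation m n) → insert i j π ⟨$⟩ʳ i ≡ j
insert-lookup i j π with i ≟ i
... | yes _   = refl
... | no i≢i  = contradiction refl i≢i

insert-fromℕ-inject₁ : ∀ {n} (π : Permutation′ n) i →
  insert (fromℕ n) (fromℕ n) π ⟨$⟩ʳ inject₁ i ≡ inject₁ (π ⟨$⟩ʳ i)
insert-fromℕ-inject₁ {n} π i =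
  subst₂ (λ a b → insert (fromℕ n) (fromℕ n) π ⟨$⟩ʳ a ≡ b)
         (punchIn-fromℕ i) (punchIn-fromℕ (π ⟨$⟩ʳ i))
         (insert-punchIn (fromℕ n) (fromℕ n) π i)

insert-zero-suc : ∀ {n} (π : Permutation′ n) i → insert zero (fromℕ n) π ⟨$⟩ʳ suc i ≡ inject₁ (π ⟨$⟩ʳ i)
insert-zero-suc π i = trans (insert-punchIn zero _ π i) (punchIn-fromℕ _)

∈-below⁺ : ∀ {s} {i j : Fin s} → i < j → i ∈ₗ below j
∈-below⁺ {i = i} {j} i<j = ∈-filter⁺ (_<? j) (∈-allFin i) i<j

∈-below⁻ : ∀ {s} {i j : Fin s} → i ∈ₗ below j → i < j
∈-below⁻ {s} {j = j} i∈ = proj₂ (∈-filter⁻ (_<? j) {xs = allFin s} i∈)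

∈-⋃⁺ : ∀ {n} {p : Subset n} {ps} → p ∈ₗ ps → p ⊆ ⋃ ps
∈-⋃⁺ (here refl)  x∈p = x∈p∪q⁺ (inj₁ x∈p)
∈-⋃⁺ (there p∈ps) x∈p = x∈p∪q⁺ (inj₂ (∈-⋃⁺ p∈ps x∈p))

∈-⋃⁻ : ∀ {n} (ps : List (Subset n)) {x} → x ∈ ⋃ ps → ∃ λ p → p ∈ₗ ps × x ∈ p
∈-⋃⁻ []       x∈⊥ = ⊥-elim (∉⊥ x∈⊥)
∈-⋃⁻ (p ∷ ps) x∈  with x∈p∪q⁻ p (⋃ ps) x∈
... | inj₁ x∈p = p , here refl , x∈p
... | inj₂ x∈⋃ps with ∈-⋃⁻ ps x∈⋃ps
...   | q , q∈ps , x∈q = q , there q∈ps , x∈q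

⋃-mono : ∀ {n} {ps qs : List (Subset n)} → ps ⊆ₗ qs → ⋃ ps ⊆ ⋃ qs
⋃-mono {ps = ps} ps⊆qs x∈ with ∈-⋃⁻ ps x∈
... | p , p∈ps , x∈p = ∈-⋃⁺ (ps⊆qs p∈ps) x∈p

x∈p⇒1≤∣p∣ : ∀ {n} {p : Subset n} {x} → x ∈ p → 1 ℕ.≤ ∣ p ∣
x∈p⇒1≤∣p∣ {p = p} {x} x∈p = subst (ℕ._≤ ∣ p ∣) (∣⁅x⁆∣≡1 x) (p⊆q⇒∣p∣≤∣q∣ ⁅x⁆⊆p)
  where
  ⁅x⁆⊆p : ⁅ x ⁆ ⊆ p
  ⁅x⁆⊆p y∈⁅x⁆ = subst (_∈ p) (sym (x∈⁅y⁆⇒x≡y x y∈⁅x⁆)) x∈p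

∣p∣≤1⇒∈-unique : ∀ {n} {p : Subset n} {x y} → ∣ p ∣ ℕ.≤ 1 → x ∈ p → y ∈ p → x ≡ y
∣p∣≤1⇒∈-unique {x = x} {y} ∣p∣≤1 x∈p y∈p with x ≟ y
... | yes x≡y = x≡y
... | no x≢y  = contradiction 1<1 (ℕ.<-irrefl refl)
  where
  1<1 : 1 ℕ.< 1
  1<1 = ℕ.<-≤-trans (ℕ.≤-<-trans (x∈p⇒1≤∣p∣ (x∈p∧x≢y⇒x∈p-y y∈p (x≢y ∘ sym))) (x∈p⇒∣p-x∣<∣p∣ x∈p))
                    ∣p∣≤1

p∩q⊆r⇒p∩[q∪r]≡p∩r : ∀ {n} (p q r : Subset n) → p ∩ q ⊆ r → p ∩ (q ∪ r) ≡ p ∩ r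
p∩q⊆r⇒p∩[q∪r]≡p∩r p q r p∩q⊆r = ⊆-antisym to from
  where
  to : p ∩ (q ∪ r) ⊆ p ∩ r
  to x∈ with x∈p∩q⁻ p (q ∪ r) x∈
  ... | x∈p , x∈q∪r with x∈p∪q⁻ q r x∈q∪r
  ...   | inj₁ x∈q = x∈p∩q⁺ (x∈p , p∩q⊆r (x∈p∩q⁺ (x∈p , x∈q)))
  ...   | inj₂ x∈r = x∈p∩q⁺ (x∈p , x∈r)
  from : p ∩ r ⊆ p ∩ (q ∪ r)
  from x∈ with x∈p∩q⁻ p r x∈
  ... | x∈p , x∈r = x∈p∩q⁺ (x∈p , q⊆p∪q q r x∈r)

module _ {H : Hypergraph} where

  -- The admissibility condition for F, where U and W are the unions of the vertex
  -- and edge sets of the members preceding it.  Admissible 𝒩 π is, by definition,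
  -- AdmissibleSeq (𝒩 ∘ (π ⟨$⟩ʳ_)).
  Attaches : SubHyp H → Subset (n H) → Subset (m H) → Set
  Attaches F U W = (∃ λ e → (e ∈ EF F ∩ W) × (edge H e ≡ VF F ∩ U)) ⊎ (∣ VF F ∩ U ∣ ℕ.≤ 1)

  attaches-resp : ∀ {F U U′ W W′} → VF F ∩ U′ ≡ VF F ∩ U → W ⊆ W′ → Attaches F U W → Attaches F U′ W′
  attaches-resp {F} {W = W} z′≡z W⊆W′ (inj₁ (e , e∈ , e≡z)) with x∈p∩q⁻ (EF F) W e∈
  ... | e∈F , e∈W = inj₁ (e , x∈p∩q⁺ (e∈F , W⊆W′ e∈W) , trans e≡z (sym z′≡z))
  attaches-resp z′≡z _ (inj₂ ∣z∣≤1) = inj₂ (subst (λ z → ∣ z ∣ ℕ.≤ 1) (sym z′≡z) ∣z∣≤1)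

  Before : ∀ {s} → Vector (SubHyp H) s → Fin s → List (SubHyp H)
  Before G j = map G (below j)

  AdmissibleAt : ∀ {s} → Vector (SubHyp H) s → Fin s → Set
  AdmissibleAt G j = Attaches (G j) (⋃ (map VF (Before G j))) (⋃ (map EF (Before G j)))

  AdmissibleSeq : ∀ {s} → Vector (SubHyp H) s → Set
  AdmissibleSeq G = ∀ j → AdmissibleAt G j

  sharedVertices : ∀ {s} → Vector (SubHyp H) s → Fin s → Subset (n H)
  sharedVertices G j = VF (G j) ∩ ⋃ (map VF (Before G j))

  ⋃-Before⁺ : ∀ {s N} (f : SubHyp H → Subset N) (G : Vector (SubHyp H) s) {i j} →
              i < j → f (G i) ⊆ ⋃ (map f (Before G j))
  ⋃-Before⁺ f G i<j = ∈-⋃⁺ (∈-map⁺ f (∈-map⁺ G (∈-below⁺ i<j)))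

  ⋃-Before⁻ : ∀ {s N} (f : SubHyp H → Subset N) (G : Vector (SubHyp H) s) j {x} →
              x ∈ ⋃ (map f (Before G j)) → ∃ λ i → i < j × x ∈ f (G i)
  ⋃-Before⁻ f G j x∈ with ∈-⋃⁻ (map f (Before G j)) x∈
  ... | p , p∈ , x∈p with ∈-map⁻ f p∈
  ...   | F , F∈ , refl with ∈-map⁻ G F∈
  ...     | i , i∈ , refl = i , ∈-below⁻ i∈ , x∈p

  Before-⊆ : ∀ {s s′} (G : Vector (SubHyp H) s) (G′ : Vector (SubHyp H) s′) {j j′} →
             (∀ {i} → i < j → ∃ λ i′ → i′ < j′ × G′ i′ ≡ G i) → Before G j ⊆ₗ Before G′ j′
  Before-⊆ G G′ {j′ = j′} reindex F∈ with ∈-map⁻ G F∈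
  ... | i , i∈ , refl with reindex (∈-below⁻ i∈)
  ...   | i′ , i′<j′ , G′i′≡Gi = subst (_∈ₗ Before G′ j′) G′i′≡Gi (∈-map⁺ G′ (∈-below⁺ i′<j′))

  admissibleAt-transfer : ∀ {s s′} {G : Vector (SubHyp H) s} {G′ : Vector (SubHyp H) s′} {j j′} →
    G j ≡ G′ j′ → Before G j ⊆ₗ Before G′ j′ → Before G′ j′ ⊆ₗ Before G j →
    AdmissibleAt G j → AdmissibleAt G′ j′
  admissibleAt-transfer {G = G} {G′} {j} {j′} Gj≡G′j′ ⊆′ ⊇′ adm =
    attaches-resp {F = G′ j′} (cong (VF (G′ j′) ∩_) U′≡U) (⋃-mono (⊆ₗ.map⁺ EF ⊆′))
                  (subst (λ F → Attaches F (⋃ (map VF (Before G j))) (⋃ (map EF (Before G j)))) Gj≡G′j′ adm)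
    where
    U′≡U : ⋃ (map VF (Before G′ j′)) ≡ ⋃ (map VF (Before G j))
    U′≡U = ⊆-antisym (⋃-mono (⊆ₗ.map⁺ VF ⊇′)) (⋃-mono (⊆ₗ.map⁺ VF ⊆′))

  admissibleSeq-cong : ∀ {s} {G G′ : Vector (SubHyp H) s} → G ≗ G′ → AdmissibleSeq G → AdmissibleSeq G′
  admissibleSeq-cong {G = G} {G′} G≗G′ adm j =
    admissibleAt-transfer (G≗G′ j) (Before-⊆ G G′ λ {i} i<j → i , i<j , sym (G≗G′ i))
                                   (Before-⊆ G′ G λ {i} i<j → i , i<j , G≗G′ i) (adm j)

  ⋃-Before-zero : ∀ {s N} (f : SubHyp H → Subset N) (G : Vector (SubHyp H) (suc s)) →
                  ⋃ (map f (Before G zero)) ≡ ⊥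
  ⋃-Before-zero f G = ⊆-antisym U⊆⊥ ⊥⊆
    where
    U⊆⊥ : ⋃ (map f (Before G zero)) ⊆ ⊥
    U⊆⊥ x∈ with ⋃-Before⁻ f G zero x∈
    ... | _ , () , _

  admissibleAt-zero : ∀ {s} (G : Vector (SubHyp H) (suc s)) → AdmissibleAt G zero
  admissibleAt-zero G = inj₂ (begin
    ∣ VF (G zero) ∩ U ∣  ≤⟨ ∣p∩q∣≤∣q∣ (VF (G zero)) U ⟩
    ∣ U ∣                ≡⟨ cong ∣_∣ (⋃-Before-zero VF G) ⟩
    ∣ ⊥ {n H} ∣          ≡⟨ ∣⊥∣≡0 (n H) ⟩
    0                    ≤⟨ z≤n ⟩
    1                    ∎)
    where
    open ℕ.≤-Reasoning
    U = ⋃ (map VF (Before G zero))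

  Before-init-⊆ : ∀ {s} (G : Vector (SubHyp H) (suc s)) j → Before (init G) j ⊆ₗ Before G (inject₁ j)
  Before-init-⊆ G j = Before-⊆ (init G) G λ {i} i<j → inject₁ i , inject₁-mono-< i<j , refl

  Before-inject₁-⊆ : ∀ {s} (G : Vector (SubHyp H) (suc s)) j → Before G (inject₁ j) ⊆ₗ Before (init G) j
  Before-inject₁-⊆ {s} G j = Before-⊆ G (init G) cover
    where
    cover : ∀ {i} → i < inject₁ j → ∃ λ k → k < j × init G k ≡ G i
    cover i<j with <-inject₁⁻ i<j
    ... | k , k<j , refl = k , k<j , refl

  Before-last-⊆ : ∀ {s} (G G′ : Vector (SubHyp H) (suc s)) → (∀ k → ∃ λ k′ → init G′ k′ ≡ init G k) →
                  Before G (fromℕ s) ⊆ₗ Before G′ (fromℕ s)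
  Before-last-⊆ {s} G G′ reindex = Before-⊆ G G′ cover
    where
    cover : ∀ {i} → i < fromℕ s → ∃ λ i′ → i′ < fromℕ s × G′ i′ ≡ G i
    cover i<last with <-fromℕ⁻ i<last
    ... | k , refl with reindex k
    ...   | k′ , G′k′≡Gk = inject₁ k′ , inject₁<fromℕ k′ , G′k′≡Gk

  admissible-init : ∀ {s} (G : Vector (SubHyp H) (suc s)) → AdmissibleSeq G → AdmissibleSeq (init G)
  admissible-init G adm j = admissibleAt-transfer refl (Before-inject₁-⊆ G j) (Before-init-⊆ G j) (adm (inject₁ j))

  admissible-snoc : ∀ {s} (G : Vector (SubHyp H) (suc s)) →
                    AdmissibleSeq (init G) → AdmissibleAt G (fromℕ s) → AdmissibleSeq G
  admissible-snoc G adm admLast j with lastView j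
  ... | last-view      = admLast
  ... | inject₁-view i = admissibleAt-transfer refl (Before-init-⊆ G i) (Before-inject₁-⊆ G i) (adm i)

  Before-suc-⊆ : ∀ {s} B (G : Vector (SubHyp H) s) j → Before G j ⊆ₗ Before (B Vector.∷ G) (suc j)
  Before-suc-⊆ B G j = Before-⊆ G (B Vector.∷ G) λ {i} i<j → suc i , s≤s i<j , refl

  ⋃-Before-suc : ∀ {s N} (f : SubHyp H → Subset N) B (G : Vector (SubHyp H) s) j →
                 ⋃ (map f (Before (B Vector.∷ G) (suc j))) ≡ f B ∪ ⋃ (map f (Before G j))
  ⋃-Before-suc f B G j = ⊆-antisym to from
    where
    to : ⋃ (map f (Before (B Vector.∷ G) (suc j))) ⊆ f B ∪ ⋃ (map f (Before G j))
    to x∈ with ⋃-Before⁻ f (B Vector.∷ G) (suc j) x∈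
    ... | zero  , _         , x∈B  = x∈p∪q⁺ (inj₁ x∈B)
    ... | suc i , s≤s i<j , x∈Gi = x∈p∪q⁺ (inj₂ (⋃-Before⁺ f G i<j x∈Gi))
    from : f B ∪ ⋃ (map f (Before G j)) ⊆ ⋃ (map f (Before (B Vector.∷ G) (suc j)))
    from x∈ with x∈p∪q⁻ (f B) _ x∈
    ... | inj₁ x∈B = ⋃-Before⁺ f (B Vector.∷ G) {i = zero} (s≤s z≤n) x∈B
    ... | inj₂ x∈U = ⋃-mono (⊆ₗ.map⁺ f (Before-suc-⊆ B G j)) x∈U

  admissible-cons : ∀ {s} B (G : Vector (SubHyp H) (suc s)) → AdmissibleSeq G →
                    Attaches (G zero) (VF B) (EF B) → (∀ t → VF (G t) ∩ VF B ⊆ VF (G zero)) →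
                    AdmissibleSeq (B Vector.∷ G)
  admissible-cons B G _ _ _ zero = admissibleAt-zero (B Vector.∷ G)
  admissible-cons B G _ G₀-attaches _ (suc zero) =
    attaches-resp {F = G zero} (cong (VF (G zero) ∩_) U₁≡B)
                  (⋃-Before⁺ EF (B Vector.∷ G) {i = zero} {j = suc zero} (s≤s z≤n)) G₀-attaches
    where
    open ≡-Reasoning
    U₁≡B : ⋃ (map VF (Before (B Vector.∷ G) (suc zero))) ≡ VF B
    U₁≡B = begin
      ⋃ (map VF (Before (B Vector.∷ G) (suc zero))) ≡⟨ ⋃-Before-suc VF B G zero ⟩
      VF B ∪ ⋃ (map VF (Before G zero))             ≡⟨ cong (VF B ∪_) (⋃-Before-zero VF G) ⟩
      VF B ∪ ⊥                                       ≡⟨ ∪-identityʳ (VF B) ⟩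
      VF B                                           ∎
  admissible-cons B G adm _ meet⊆G₀ (suc (suc t)) =
    attaches-resp {F = G (suc t)} U≡ (⋃-mono (⊆ₗ.map⁺ EF (Before-suc-⊆ B G (suc t)))) (adm (suc t))
    where
    U≡ : VF (G (suc t)) ∩ ⋃ (map VF (Before (B Vector.∷ G) (suc (suc t))))
       ≡ VF (G (suc t)) ∩ ⋃ (map VF (Before G (suc t)))
    U≡ = trans (cong (VF (G (suc t)) ∩_) (⋃-Before-suc VF B G (suc t)))
               (p∩q⊆r⇒p∩[q∪r]≡p∩r _ _ _ (⋃-Before⁺ VF G {i = zero} (s≤s z≤n) ∘ meet⊆G₀ (suc t)))

  init∩last⊆sharedVertices : ∀ {s} (G : Vector (SubHyp H) (suc s)) k →
                             VF (init G k) ∩ VF (last G) ⊆ sharedVertices G (fromℕ s)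
  init∩last⊆sharedVertices G k x∈ with x∈p∩q⁻ (VF (init G k)) (VF (last G)) x∈
  ... | x∈Gk , x∈B = x∈p∩q⁺ (x∈B , ⋃-Before⁺ VF G (inject₁<fromℕ k) x∈Gk)

  attachmentOfLast : ∀ {s} (G : Vector (SubHyp H) (suc (suc s))) → AdmissibleAt G (fromℕ (suc s)) →
    ∃ λ j₀ → (∀ k → VF (init G k) ∩ VF (last G) ⊆ VF (init G j₀))
           × Attaches (init G j₀) (VF (last G)) (EF (last G))
  attachmentOfLast {s} G (inj₁ (e , e∈ , e≡z)) with x∈p∩q⁻ (EF (last G)) _ e∈
  ... | e∈B , e∈W with ⋃-Before⁻ EF G (fromℕ (suc s)) e∈W
  ...   | i , i<last , e∈Gi with <-fromℕ⁻ i<last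
  ...     | j₀ , refl = j₀ , (λ k → e⊆Gj₀ ∘ z⊆e ∘ init∩last⊆sharedVertices G k)
                         , inj₁ (e , x∈p∩q⁺ (e∈Gi , e∈B) , e≡meet)
    where
    e⊆Gj₀ : edge H e ⊆ VF (init G j₀)
    e⊆Gj₀ = closed (init G j₀) e e∈Gi
    z⊆e : sharedVertices G (fromℕ (suc s)) ⊆ edge H e
    z⊆e = subst (_ ∈_) (sym e≡z)
    e≡meet : edge H e ≡ VF (init G j₀) ∩ VF (last G)
    e≡meet = ⊆-antisym (λ x∈e → x∈p∩q⁺ (e⊆Gj₀ x∈e , proj₁ (x∈p∩q⁻ _ _ (subst (_ ∈_) e≡z x∈e))))
                       (z⊆e ∘ init∩last⊆sharedVertices G j₀)
  attachmentOfLast {s} G (inj₂ ∣z∣≤1) with nonempty? (sharedVertices G (fromℕ (suc s)))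
  ... | no empty = zero , (λ k x∈ → contradiction (_ , init∩last⊆sharedVertices G k x∈) empty)
                        , inj₂ (ℕ.≤-trans (p⊆q⇒∣p∣≤∣q∣ (init∩last⊆sharedVertices G zero)) ∣z∣≤1)
  ... | yes (v , v∈z) with ⋃-Before⁻ VF G (fromℕ (suc s)) (proj₂ (x∈p∩q⁻ (VF (last G)) _ v∈z))
  ...   | i , i<last , v∈Gi with <-fromℕ⁻ i<last
  ...     | j₀ , refl = j₀ , (λ k x∈ → subst (_∈ VF (init G j₀)) (v≡ k x∈) v∈Gi)
                         , inj₂ (ℕ.≤-trans (p⊆q⇒∣p∣≤∣q∣ (init∩last⊆sharedVertices G j₀)) ∣z∣≤1)
    where
    v≡ : ∀ k {x} → x ∈ VF (init G k) ∩ VF (last G) → v ≡ x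
    v≡ k x∈ = ∣p∣≤1⇒∈-unique ∣z∣≤1 v∈z (init∩last⊆sharedVertices G k x∈)

  admissible-keepLast : ∀ {s} (G : Vector (SubHyp H) (suc s)) (τ : Permutation′ s) →
    AdmissibleSeq G → AdmissibleSeq (init G ∘ (τ ⟨$⟩ʳ_)) →
    AdmissibleSeq (G ∘ (insert (fromℕ s) (fromℕ s) τ ⟨$⟩ʳ_))
  admissible-keepLast {s} G τ adm adm′ =
    admissible-snoc (G ∘ (σ ⟨$⟩ʳ_)) (admissibleSeq-cong init≗ adm′) atLast
    where
    σ = insert (fromℕ s) (fromℕ s) τ
    init≗ : init G ∘ (τ ⟨$⟩ʳ_) ≗ init (G ∘ (σ ⟨$⟩ʳ_))
    init≗ k = cong G (sym (insert-fromℕ-inject₁ τ k))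
    atLast : AdmissibleAt (G ∘ (σ ⟨$⟩ʳ_)) (fromℕ s)
    atLast = admissibleAt-transfer (cong G (sym (insert-lookup (fromℕ s) (fromℕ s) τ)))
               (Before-last-⊆ G (G ∘ (σ ⟨$⟩ʳ_)) λ k → τ ⟨$⟩ˡ k , trans (sym (init≗ _)) (cong (init G) (inverseʳ τ)))
               (Before-last-⊆ (G ∘ (σ ⟨$⟩ʳ_)) G λ k → τ ⟨$⟩ʳ k , init≗ k)
               (adm (fromℕ s))

  admissible-lastFirst : ∀ {s} (G : Vector (SubHyp H) (suc (suc s))) (τ : Permutation′ (suc s)) →
    AdmissibleSeq (init G ∘ (τ ⟨$⟩ʳ_)) →
    Attaches (init G (τ ⟨$⟩ʳ zero)) (VF (last G)) (EF (last G)) →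
    (∀ k → VF (init G k) ∩ VF (last G) ⊆ VF (init G (τ ⟨$⟩ʳ zero))) →
    AdmissibleSeq (G ∘ (insert zero (fromℕ (suc s)) τ ⟨$⟩ʳ_))
  admissible-lastFirst {s} G τ adm′ attaches meet⊆ =
    admissibleSeq-cong cons≗
      (admissible-cons (last G) (init G ∘ (τ ⟨$⟩ʳ_)) adm′ attaches (λ t → meet⊆ (τ ⟨$⟩ʳ t)))
    where
    cons≗ : last G Vector.∷ (init G ∘ (τ ⟨$⟩ʳ_)) ≗ G ∘ (insert zero (fromℕ (suc s)) τ ⟨$⟩ʳ_)
    cons≗ zero    = cong G (sym (insert-lookup zero (fromℕ (suc s)) τ))
    cons≗ (suc t) = cong G (sym (insert-zero-suc τ t))

  moveToFront : ∀ {s} (G : Vector (SubHyp H) (suc s)) → AdmissibleSeq G → ∀ p →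
    ∃ λ (τ : Permutation′ (suc s)) → AdmissibleSeq (G ∘ (τ ⟨$⟩ʳ_)) × τ ⟨$⟩ʳ zero ≡ p
  moveToFront {zero} G adm zero = id , adm , refl
  moveToFront {suc s} G adm p with lastView p
  ... | inject₁-view p′ with moveToFront (init G) (admissible-init G adm) p′
  ...   | τ , adm′ , τ0≡p′ =
          insert (fromℕ (suc s)) (fromℕ (suc s)) τ , admissible-keepLast G τ adm adm′
        , trans (insert-fromℕ-inject₁ τ zero) (cong inject₁ τ0≡p′)
  moveToFront {suc s} G adm p | last-view with attachmentOfLast G (adm (fromℕ (suc s)))
  ... | j₀ , meet⊆ , attaches with moveToFront (init G) (admissible-init G adm) j₀
  ...   | τ , adm′ , refl =
          insert zero (fromℕ (suc s)) τ , admissible-lastFirst G τ adm′ attaches meet⊆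
        , insert-lookup zero (fromℕ (suc s)) τ

lemma13p3 : (H : Hypergraph) → Linear H → (r : ℕ) → (𝒩 : Fin r → SubHyp H) → Distinct 𝒩 → ForestOfCopies 𝒩 → (a : Fin r) → Initial 𝒩 a
lemma13p3 _ _ zero _ _ _ ()
lemma13p3 H _ (suc s) 𝒩 _ (π , adm) a with moveToFront (𝒩 ∘ (π ⟨$⟩ʳ_)) adm (π ⟨$⟩ˡ a)
... | τ , adm′ , τ0≡πˡa = τ ∘ₚ π , adm′ , cong toℕ (trans (cong (τ ⟨$⟩ˡ_) (sym τ0≡πˡa)) (inverseˡ τ))
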